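{- Every derivation in $\mathsf{G3QK}(\mathcal{C})$ can be transformed into a derivation in $\mathsf{QK}(\mathcal{C})\mathsf{L}$.
   Context: Language: first-order modal formulae from atoms $p(\vec{x})$, $\bot$ with $\neg,\lor,\Diamond,\exists$. $\mathcal{C}$ is a set of frame conditions drawn from: seriality $S$; general path conditions $G(n,k)$ (if $wR^{n}u$ and $wR^{k}v$ then $uRv$); increasing domains $I_{d}$; decreasing domains $D_{d}$; constant domains $C_{d}$ (treated as both $I_d$ and $D_d$); non-empty domains $N_{d}$. Let $\mathcal{G}$ be the set of $G(n,k)\in\mathcal{C}$. Strings over $\{\Diamond,\Diamond^{ -1}\}$ ($\Diamond$ forward move, $\Diamond^{ -1}$ backward move, the "black diamond"). For a semi-Thue system $\mathrm{S}$ (productions $a\longrightarrow s$), $L_{\mathrm{S}}(a)$ is the set of strings derivable from $a$ by repeated rewriting. $\mathrm{S}(\mathcal{G})$ contains $\Diamond\longrightarrow(\Diamond^{ -1})^{n}\Diamond^{k}$ and $\Diamond^{ -1}\longrightarrow(\Diamond^{ -1})^{k}\Diamond^{n}$ for each $G(n,k)\in\mathcal{G}$; $\mathrm{S4}=\{\Diamond\longrightarrow\varepsilon,\Diamond^{ -1}\longrightarrow\varepsilon,\Diamond\longrightarrow\Diamond\Diamond,\Diamond^{ -1}\longrightarrow\Diamond^{ -1}\Diamond^{ -1}\}$; $\mathrm{S5}=\{\Diamond\longrightarrow\varepsilon,\Diamond^{ -1}\longrightarrow\varepsilon,\Diamond\longrightarrow\Diamond^{ -1}\Diamond,\Diamond^{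 -1}\longrightarrow\Diamond^{ -1}\Diamond\}$. Labeled sequents $\mathcal{R},\Gamma\vdash\Delta$ ($\mathcal{R}$: relational atoms $wRu$, domain atoms $x\in D(w)$; labeled formulae $w:\phi$). Propagation graph of $\mathcal{R}$: vertices labels, edges $(w,\Diamond,u)$ and $(u,\Diamond^{ -1},w)$ for each $wRu\in\mathcal{R}$; a propagation path's string is its sequence of edge characters ($\varepsilon$ if empty). $y$ is $(\mathrm{S},a)$-available for $w$ iff for some $u$, $y\in D(u)\in\mathcal{R}$ and some path from $w$ to $u$ has string in $L_{\mathrm{S}}(a)$. $\mathsf{G3QK}$: $(ax)$ $\mathcal{R},\Gamma,w:p(\vec{x})\vdash w:p(\vec{x}),\Delta$; $(\bot_l)$; left/right rules for $\neg,\lor$; $(\Diamond_l)$ (from $\mathcal{R},wRu,\Gamma,u:\phi\vdash\Delta$ infer $\mathcal{R},\Gamma,w:\Diamond\phi\vdash\Delta$, $u$ fresh); $(\Diamond_r)$ (from $\mathcal{R},wRu,\Gamma\vdash w:\Diamond\phi,u:\phi,\Delta$ infer $\mathcal{R},wRu,\Gamma\vdash w:\Diamond\phi,\Delta$); $(\exists_l)$ (from $\mathcal{R},y\in D(w),\Gamma,w:\phi[y/x]\vdash\Delta$ infer $\mathcal{R},\Gamma,w:\exists x\phi\vdash\Delta$, $y$ fresh); $(\exists_r)$ (from $\mathcal{R},y\in D(w),\Gamma\vdash w:\exists x\phi,w:\phi[y/x],\Delta$ infer $\mathcal{R},y\in D(w),\Gamma\vdash w:\exists x\phi,\Delta$).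 $\mathsf{G3QK}(\mathcal{C})$ adds: $(d)$ (add $wRu$, $u$ fresh) iff $S\in\mathcal{C}$; $(g_{n,k})$ (add $uRv$ given $wR^nu,wR^kv$) iff $G(n,k)\in\mathcal{C}$; $(id)$ (add $x\in D(u)$ given $wRu,x\in D(w)$) iff $I_d$ or $C_d\in\mathcal{C}$; $(dd)$ (add $x\in D(w)$ given $wRu,x\in D(u)$) iff $D_d$ or $C_d\in\mathcal{C}$; $(nd)$ (add $x\in D(w)$, $x$ fresh) iff $N_d\in\mathcal{C}$. Reachability rules: $(p_{\Diamond})$: from $\mathcal{R},\Gamma\vdash w:\Diamond\phi,u:\phi,\Delta$ infer $\mathcal{R},\Gamma\vdash w:\Diamond\phi,\Delta$, provided some path from $w$ to $u$ has string in $L_{\mathrm{S}(\mathcal{G})}(\Diamond)$. $(s_{\exists}^{1})$: from $\mathcal{R},\Gamma\vdash w:\phi[y/x],w:\exists x\phi,\Delta$ infer $\mathcal{R},\Gamma\vdash w:\exists x\phi,\Delta$, provided: $y$ is $(\mathrm{S5},\Diamond)$-available for $w$ (if $I_d,D_d\in\mathcal{C}$); $(\mathrm{S4}\cup\mathrm{S}(\mathcal{G}),\Diamond^{ -1})$-available (only $I_d$); $(\mathrm{S4}\cup\mathrm{S}(\mathcal{G}),\Diamond)$-available (only $D_d$); $y\in D(w)\in\mathcal{R}$ (neither). $(s_{\exists}^{2})$: from $\mathcal{R},y\in D(u),\Gamma\vdash w:\phi[y/x],w:\exists x\phi,\Delta$ infer $\mathcal{R},\Gamma\vdash w:\exists x\phi,\Delta$,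 provided $y$ fresh and some path from $w$ to $u$ has string in $L_{\mathrm{S5}}(\Diamond)$ (if $I_d,D_d\in\mathcal{C}$), $L_{\mathrm{S4}\cup\mathrm{S}(\mathcal{G})}(\Diamond^{ -1})$ (only $I_d$), $L_{\mathrm{S4}\cup\mathrm{S}(\mathcal{G})}(\Diamond)$ (only $D_d$), or $w=u$ (neither). $\mathsf{QK}(\mathcal{C})\mathsf{L}$ is $\mathsf{G3QK}(\mathcal{C})$ plus $(p_{\Diamond})$, $(s_{\exists}^{1})$, plus $(s_{\exists}^{2})$ iff $N_d\in\mathcal{C}$, minus $(g_{n,k})$, $(id)$, $(dd)$, $(nd)$. (Note $(\Diamond_r)$ and $(\exists_r)$ are instances of $(p_{\Diamond})$ and $(s_{\exists}^{1})$.) -}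

module Defs where

open import Level using (0ℓ) renaming (suc to lsuc)
open import Data.Nat using (ℕ; zero; suc)
open import Data.Bool using (Bool; true; false; _∨_; T)
open import Data.List using (List; []; _∷_; _++_; replicate; concatMap; map)
open import Data.List.Membership.Propositional using (_∈_; _∉_)
open import Data.List.Relation.Binary.Permutation.Propositional using (_↭_)
open import Data.Product using (Σ; ∃; ∃-syntax; _×_; _,_)
open import Data.Sum using (_⊎_)
open import Data.Unit using (⊤)
open import Data.Empty using (⊥)
open import Relation.Binary.PropositionalEquality using (_≡_)
open import Relation.Nullary using (¬_)

-- Syntax (locally nameless: bound variables are de Bruijn indices,
-- free first-order variables and world labels are natural numbers)

Var : Set
Var = ℕ

Label : Set
Label = ℕ

data Term : Set where
  bv : ℕ → Term
  fv : Var → Term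

data Formula : Set where
  atom  : ℕ → List Term → Formula
  ⊥f    : Formula
  ¬f_   : Formula → Formula
  _∨f_  : Formula → Formula → Formula
  ◇f_   : Formula → Formula
  ∃f_   : Formula → Formula                -- binds index 0

openT : ℕ → Var → Term → Term
openT i y (bv j) with i Data.Nat.≟ j
... | Relation.Nullary.yes _ = fv y
... | Relation.Nullary.no  _ = bv j
openT i y (fv x) = fv x

openF : ℕ → Var → Formula → Formula
openF i y (atom p ts) = atom p (map (openT i y) ts)
openF i y ⊥f          = ⊥f
openF i y (¬f φ)      = ¬f (openF i y φ)
openF i y (φ ∨f ψ)    = openF i y φ ∨f openF i y ψ
openF i y (◇f φ)      = ◇f (openF i y φ)
openF i y (∃f φ)      = ∃f (openF (suc i) y φ)

-- φ[y/x] where ∃x φ is represented as ∃f φ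
_[_] : Formula → Var → Formula
φ [ y ] = openF 0 y φ

fvT : Term → List Var
fvT (bv _) = []
fvT (fv x) = x ∷ []

fvF : Formula → List Var
fvF (atom p ts) = concatMap fvT ts
fvF ⊥f          = []
fvF (¬f φ)      = fvF φ
fvF (φ ∨f ψ)    = fvF φ ++ fvF ψ
fvF (◇f φ)      = fvF φ
fvF (∃f φ)      = fvF φ

data RAtom : Set where
  rel   : Label → Label → RAtom
  dom   : Var → Label → RAtom              -- dom x w  is  x ∈ D(w)

record LFormula : Set where
  constructor _∶_
  field
    lab  : Label
    form : Formula

infix 4 _▸_⊢_

record Sequent : Set where
  constructor _▸_⊢_
  field
    rels : List RAtom
    ant : List LFormula
    succ : List LFormula

labR : RAtom → List Label
labR (rel w u)  = w ∷ u ∷ []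
labR (dom x w) = w ∷ []

varR : RAtom → List Var
varR (rel w u)  = []
varR (dom x w) = x ∷ []

labelsS : Sequent → List Label
labelsS (R ▸ Γ ⊢ Δ) =
  concatMap labR R ++ map LFormula.lab Γ ++ map LFormula.lab Δ

varsS : Sequent → List Var
varsS (R ▸ Γ ⊢ Δ) =
  concatMap varR R ++ concatMap (λ A → fvF (LFormula.form A)) Γ
                   ++ concatMap (λ A → fvF (LFormula.form A)) Δ

record FrameConds : Set₁ where
  field
    Ser  : Bool
    Gpc  : ℕ → ℕ → Set
    Inc  : Bool
    Dec  : Bool
    Con  : Bool
    NonE : Bool

hasI : FrameConds → Bool
hasI C = FrameConds.Inc C ∨ FrameConds.Con C

hasD : FrameConds → Bool
hasD C = FrameConds.Dec C ∨ FrameConds.Con C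

data Ch : Set where
  dia  : Ch
  bdia : Ch

-- a semi-Thue system is its set of productions a ⟶ s
STS : Set₁
STS = Ch → List Ch → Set

data Derives (S : STS) (a : List Ch) : List Ch → Set where
  done : Derives S a a
  step : ∀ {l b r t} → Derives S a (l ++ b ∷ r) → S b t →
         Derives S a (l ++ t ++ r)

L : STS → Ch → List Ch → Set
L S a s = Derives S (a ∷ []) s

_∪S_ : STS → STS → STS
(S ∪S T') a s = S a s ⊎ T' a s

SG : FrameConds → STS
SG C dia  s = ∃[ n ] ∃[ k ] (FrameConds.Gpc C n k × s ≡ replicate n bdia ++ replicate k dia)
SG C bdia s = ∃[ n ] ∃[ k ] (FrameConds.Gpc C n k × s ≡ replicate k bdia ++ replicate n dia)

data S4 : STS where
  d-ε  : S4 dia []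
  b-ε  : S4 bdia []
  d-dd : S4 dia (dia ∷ dia ∷ [])
  b-bb : S4 bdia (bdia ∷ bdia ∷ [])

data S5 : STS where
  d-ε  : S5 dia []
  b-ε  : S5 bdia []
  d-bd : S5 dia (bdia ∷ dia ∷ [])
  b-bd : S5 bdia (bdia ∷ dia ∷ [])

data PPath (R : List RAtom) : Label → Label → List Ch → Set where
  here : ∀ {w} → PPath R w w []
  fwd  : ∀ {w v u s} → (rel w v) ∈ R → PPath R v u s → PPath R w u (dia ∷ s)
  bwd  : ∀ {w v u s} → (rel v w) ∈ R → PPath R v u s → PPath R w u (bdia ∷ s)

PathIn : STS → Ch → List RAtom → Label → Label → Set
PathIn S a R w u = ∃[ s ] (PPath R w u s × L S a s)

Available : STS → Ch → List RAtom → Var → Label → Set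
Available S a R y w = ∃[ u ] ((dom y u) ∈ R × PathIn S a R w u)

S1Cond : FrameConds → List RAtom → Var → Label → Set
S1Cond C R y w with hasI C | hasD C
... | true  | true  = Available S5 dia R y w
... | true  | false = Available (S4 ∪S SG C) bdia R y w
... | false | true  = Available (S4 ∪S SG C) dia R y w
... | false | false = (dom y w) ∈ R

S2Cond : FrameConds → List RAtom → Label → Label → Set
S2Cond C R w u with hasI C | hasD C
... | true  | true  = PathIn S5 dia R w u
... | true  | false = PathIn (S4 ∪S SG C) bdia R w u
... | false | true  = PathIn (S4 ∪S SG C) dia R w u
... | false | false = w ≡ u

RPow : List RAtom → ℕ → Label → Label → Set
RPow R zero    w u = w ≡ u
RPow R (suc n) w u = ∃[ v ] ((rel w v) ∈ R × RPow R n v u)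

-- G3QK(𝒞)   (contexts are lists read as multisets: the principal
-- formula is located via a permutation)

data G3QK (C : FrameConds) : Sequent → Set where
  ax   : ∀ {R Γ Δ w p ts} → (w ∶ atom p ts) ∈ Γ → (w ∶ atom p ts) ∈ Δ →
         G3QK C (R ▸ Γ ⊢ Δ)
  ⊥l   : ∀ {R Γ Δ w} → (w ∶ ⊥f) ∈ Γ → G3QK C (R ▸ Γ ⊢ Δ)
  ¬l   : ∀ {R Γ Γ' Δ w φ} → Γ ↭ ((w ∶ (¬f φ)) ∷ Γ') →
         G3QK C (R ▸ Γ' ⊢ ((w ∶ φ) ∷ Δ)) → G3QK C (R ▸ Γ ⊢ Δ)
  ¬r   : ∀ {R Γ Δ Δ' w φ} → Δ ↭ ((w ∶ (¬f φ)) ∷ Δ') →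
         G3QK C (R ▸ ((w ∶ φ) ∷ Γ) ⊢ Δ') → G3QK C (R ▸ Γ ⊢ Δ)
  ∨l   : ∀ {R Γ Γ' Δ w φ ψ} → Γ ↭ ((w ∶ (φ ∨f ψ)) ∷ Γ') →
         G3QK C (R ▸ ((w ∶ φ) ∷ Γ') ⊢ Δ) → G3QK C (R ▸ ((w ∶ ψ) ∷ Γ') ⊢ Δ) →
         G3QK C (R ▸ Γ ⊢ Δ)
  ∨r   : ∀ {R Γ Δ Δ' w φ ψ} → Δ ↭ ((w ∶ (φ ∨f ψ)) ∷ Δ') →
         G3QK C (R ▸ Γ ⊢ ((w ∶ φ) ∷ (w ∶ ψ) ∷ Δ')) → G3QK C (R ▸ Γ ⊢ Δ)
  ◇l   : ∀ {R Γ Γ' Δ w u φ} → Γ ↭ ((w ∶ (◇f φ)) ∷ Γ') →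
         u ∉ labelsS (R ▸ Γ ⊢ Δ) →
         G3QK C (((rel w u) ∷ R) ▸ ((u ∶ φ) ∷ Γ') ⊢ Δ) → G3QK C (R ▸ Γ ⊢ Δ)
  ◇r   : ∀ {R Γ Δ w u φ} → (rel w u) ∈ R → (w ∶ (◇f φ)) ∈ Δ →
         G3QK C (R ▸ Γ ⊢ ((u ∶ φ) ∷ Δ)) → G3QK C (R ▸ Γ ⊢ Δ)
  ∃l   : ∀ {R Γ Γ' Δ w y φ} → Γ ↭ ((w ∶ (∃f φ)) ∷ Γ') →
         y ∉ varsS (R ▸ Γ ⊢ Δ) →
         G3QK C (((dom y w) ∷ R) ▸ ((w ∶ (φ [ y ])) ∷ Γ') ⊢ Δ) → G3QK C (R ▸ Γ ⊢ Δ)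
  ∃r   : ∀ {R Γ Δ w y φ} → (dom y w) ∈ R → (w ∶ (∃f φ)) ∈ Δ →
         G3QK C (R ▸ Γ ⊢ ((w ∶ (φ [ y ])) ∷ Δ)) → G3QK C (R ▸ Γ ⊢ Δ)
  d    : ∀ {R Γ Δ w u} → T (FrameConds.Ser C) → u ∉ labelsS (R ▸ Γ ⊢ Δ) →
         G3QK C (((rel w u) ∷ R) ▸ Γ ⊢ Δ) → G3QK C (R ▸ Γ ⊢ Δ)
  g    : ∀ {R Γ Δ w u v n k} → FrameConds.Gpc C n k →
         RPow R n w u → RPow R k w v →
         G3QK C (((rel u v) ∷ R) ▸ Γ ⊢ Δ) → G3QK C (R ▸ Γ ⊢ Δ)
  id   : ∀ {R Γ Δ w u x} → T (hasI C) → (rel w u) ∈ R → (dom x w) ∈ R →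
         G3QK C (((dom x u) ∷ R) ▸ Γ ⊢ Δ) → G3QK C (R ▸ Γ ⊢ Δ)
  dd   : ∀ {R Γ Δ w u x} → T (hasD C) → (rel w u) ∈ R → (dom x u) ∈ R →
         G3QK C (((dom x w) ∷ R) ▸ Γ ⊢ Δ) → G3QK C (R ▸ Γ ⊢ Δ)
  nd   : ∀ {R Γ Δ w x} → T (FrameConds.NonE C) → x ∉ varsS (R ▸ Γ ⊢ Δ) →
         G3QK C (((dom x w) ∷ R) ▸ Γ ⊢ Δ) → G3QK C (R ▸ Γ ⊢ Δ)

data QKL (C : FrameConds) : Sequent → Set where
  ax   : ∀ {R Γ Δ w p ts} → (w ∶ atom p ts) ∈ Γ → (w ∶ atom p ts) ∈ Δ →
         QKL C (R ▸ Γ ⊢ Δ)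
  ⊥l   : ∀ {R Γ Δ w} → (w ∶ ⊥f) ∈ Γ → QKL C (R ▸ Γ ⊢ Δ)
  ¬l   : ∀ {R Γ Γ' Δ w φ} → Γ ↭ ((w ∶ (¬f φ)) ∷ Γ') →
         QKL C (R ▸ Γ' ⊢ ((w ∶ φ) ∷ Δ)) → QKL C (R ▸ Γ ⊢ Δ)
  ¬r   : ∀ {R Γ Δ Δ' w φ} → Δ ↭ ((w ∶ (¬f φ)) ∷ Δ') →
         QKL C (R ▸ ((w ∶ φ) ∷ Γ) ⊢ Δ') → QKL C (R ▸ Γ ⊢ Δ)
  ∨l   : ∀ {R Γ Γ' Δ w φ ψ} → Γ ↭ ((w ∶ (φ ∨f ψ)) ∷ Γ') →
         QKL C (R ▸ ((w ∶ φ) ∷ Γ') ⊢ Δ) → QKL C (R ▸ ((w ∶ ψ) ∷ Γ') ⊢ Δ) →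
         QKL C (R ▸ Γ ⊢ Δ)
  ∨r   : ∀ {R Γ Δ Δ' w φ ψ} → Δ ↭ ((w ∶ (φ ∨f ψ)) ∷ Δ') →
         QKL C (R ▸ Γ ⊢ ((w ∶ φ) ∷ (w ∶ ψ) ∷ Δ')) → QKL C (R ▸ Γ ⊢ Δ)
  ◇l   : ∀ {R Γ Γ' Δ w u φ} → Γ ↭ ((w ∶ (◇f φ)) ∷ Γ') →
         u ∉ labelsS (R ▸ Γ ⊢ Δ) →
         QKL C (((rel w u) ∷ R) ▸ ((u ∶ φ) ∷ Γ') ⊢ Δ) → QKL C (R ▸ Γ ⊢ Δ)
  ◇r   : ∀ {R Γ Δ w u φ} → (rel w u) ∈ R → (w ∶ (◇f φ)) ∈ Δ →
         QKL C (R ▸ Γ ⊢ ((u ∶ φ) ∷ Δ)) → QKL C (R ▸ Γ ⊢ Δ)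
  ∃l   : ∀ {R Γ Γ' Δ w y φ} → Γ ↭ ((w ∶ (∃f φ)) ∷ Γ') →
         y ∉ varsS (R ▸ Γ ⊢ Δ) →
         QKL C (((dom y w) ∷ R) ▸ ((w ∶ (φ [ y ])) ∷ Γ') ⊢ Δ) → QKL C (R ▸ Γ ⊢ Δ)
  ∃r   : ∀ {R Γ Δ w y φ} → (dom y w) ∈ R → (w ∶ (∃f φ)) ∈ Δ →
         QKL C (R ▸ Γ ⊢ ((w ∶ (φ [ y ])) ∷ Δ)) → QKL C (R ▸ Γ ⊢ Δ)
  d    : ∀ {R Γ Δ w u} → T (FrameConds.Ser C) → u ∉ labelsS (R ▸ Γ ⊢ Δ) →
         QKL C (((rel w u) ∷ R) ▸ Γ ⊢ Δ) → QKL C (R ▸ Γ ⊢ Δ)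
  p◇   : ∀ {R Γ Δ w u φ} → PathIn (SG C) dia R w u → (w ∶ (◇f φ)) ∈ Δ →
         QKL C (R ▸ Γ ⊢ ((u ∶ φ) ∷ Δ)) → QKL C (R ▸ Γ ⊢ Δ)
  s∃¹  : ∀ {R Γ Δ w y φ} → S1Cond C R y w → (w ∶ (∃f φ)) ∈ Δ →
         QKL C (R ▸ Γ ⊢ ((w ∶ (φ [ y ])) ∷ Δ)) → QKL C (R ▸ Γ ⊢ Δ)
  s∃²  : ∀ {R Γ Δ w u y φ} → T (FrameConds.NonE C) →
         y ∉ varsS (R ▸ Γ ⊢ Δ) → S2Cond C R w u → (w ∶ (∃f φ)) ∈ Δ →
         QKL C (((dom y u) ∷ R) ▸ Γ ⊢ ((w ∶ (φ [ y ])) ∷ Δ)) → QKL C (R ▸ Γ ⊢ Δ)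

-- Each structural rule of G3QK(𝒞) is eliminated from a derivation that already lives in QK(𝒞)L.
-- The atom added by (g), (id) or (dd) is redundant over the other relational atoms: a propagation
-- path crossing a new edge u R v is rerouted through w Rⁿ u and w Rᵏ v, its string changing by one
-- production of S(𝒢); and a new x ∈ D(u) can be traded for x ∈ D(w) one edge away, a step that the
-- path languages of (s∃¹) absorb under increasing (resp. decreasing) domains.  So the side
-- conditions of (p◇), (s∃¹) and (s∃²) survive deleting the atom, since both (s∃) conditions say
-- "reach, by an admissible path, a label whose domain holds y".  The atom x ∈ D(w) added by (nd)
-- is not redundant, but x is fresh, so only (s∃¹) steps instantiating with x use it, and each of
-- them becomes an (s∃²) step introducing x ∈ D(w) on the spot.

module Submission where

open import Defs
open import Data.Nat using (zero; suc; _≟_)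
open import Data.Bool using (true; false; T)
open import Data.List using (List; []; _∷_; _++_; replicate; concatMap; map)
open import Data.List.Properties using (++-assoc; ++-identityʳ)
open import Data.List.Relation.Unary.Any using (here; there)
open import Data.List.Relation.Unary.All using (All; _∷_; lookup; uncons)
open import Data.List.Relation.Unary.All.Properties using (All¬⇒¬Any; ¬Any⇒All¬)
open import Data.List.Membership.Propositional using (_∈_; _∉_; find)
open import Data.List.Membership.Propositional.Properties
  using (∈-++⁺ˡ; ∈-++⁺ʳ; ∈-++⁻; ∈-map⁺; ∈-concat⁺′; ∈-concatMap⁺; ∈-concatMap⁻)
open import Data.List.Relation.Binary.Subset.Propositional using (_⊆_)
open import Data.List.Relation.Binary.Subset.Propositional.Properties
  using (⊆-refl; ⊆-trans; ⊆-reflexive-↭; xs⊆x∷xs; ∷⁺ʳ; ∈-∷⁺ʳ; ++⁺ˡ; concatMap⁺)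
open import Data.List.Relation.Binary.Permutation.Propositional as ↭ using (_↭_)
open import Data.List.Relation.Binary.Permutation.Propositional.Properties using (All-resp-↭)
open import Data.Product using (∃-syntax; _×_; _,_; proj₁)
open import Data.Sum using (inj₁; inj₂)
open import Data.Empty using (⊥-elim)
open import Function using (_∘_)
open import Relation.Binary.PropositionalEquality using (_≡_; _≢_; refl; sym; trans; cong; subst)
open import Relation.Nullary using (yes; no)

module _ {S : STS} where

  step-at : ∀ {a s s'} l {b t} r → Derives S a s → s ≡ l ++ b ∷ r → S b t →
            l ++ t ++ r ≡ s' → Derives S a s'
  step-at l r δ refl p refl = step {l = l} {r = r} δ p

  rewrite-once : ∀ {b t} → S b t → Derives S (b ∷ []) t
  rewrite-once {t = t} p = step-at [] [] done refl p (++-identityʳ t)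

  Derives-trans : ∀ {a b c} → Derives S a b → Derives S b c → Derives S a c
  Derives-trans δ done       = δ
  Derives-trans δ (step e p) = step (Derives-trans δ e) p

  Derives-++ˡ : ∀ p {a b} → Derives S a b → Derives S (p ++ a) (p ++ b)
  Derives-++ˡ p done = done
  Derives-++ˡ p (step {l = l} {b} {r} {t} δ q) =
    step-at (p ++ l) r (Derives-++ˡ p δ) (sym (++-assoc p l (b ∷ r))) q (++-assoc p l (t ++ r))

  Derives-++ʳ : ∀ q {a b} → Derives S a b → Derives S (a ++ q) (b ++ q)
  Derives-++ʳ q done = done
  Derives-++ʳ q (step {l = l} {b} {r} {t} δ p) =
    step-at l (r ++ q) (Derives-++ʳ q δ) (++-assoc l (b ∷ r) q) p
      (sym (trans (++-assoc l (t ++ r) q) (cong (l ++_) (++-assoc t r q))))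

  Derives-++ : ∀ {a a' b b'} → Derives S a a' → Derives S b b' → Derives S (a ++ b) (a' ++ b')
  Derives-++ {a' = a'} {b = b} da db = Derives-trans (Derives-++ʳ b da) (Derives-++ˡ a' db)

Derives-mono : ∀ {S S' : STS} → (∀ {b t} → S b t → S' b t) →
               ∀ {a s} → Derives S a s → Derives S' a s
Derives-mono f done       = done
Derives-mono f (step δ p) = step (Derives-mono f δ) (f p)

S5-universal : ∀ s → L S5 dia s
S5-universal s = subst (L S5 dia) (++-identityʳ s)
  (Derives-trans (before-dia s) (Derives-++ˡ s (rewrite-once d-ε)))
  where
  prepend : ∀ c → Derives S5 (dia ∷ []) (c ∷ dia ∷ [])
  prepend bdia = rewrite-once d-bd
  prepend dia  = Derives-trans (rewrite-once d-bd)
    (Derives-trans (Derives-++ʳ (dia ∷ []) (rewrite-once b-bd))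
      (Derives-++ʳ (dia ∷ dia ∷ []) (rewrite-once b-ε)))

  before-dia : ∀ s → Derives S5 (dia ∷ []) (s ++ dia ∷ [])
  before-dia []      = done
  before-dia (c ∷ s) = Derives-trans (prepend c) (Derives-++ˡ (c ∷ []) (before-dia s))

module _ {G : STS} where

  S4∪-doubling : ∀ a → (S4 ∪S G) a (a ∷ a ∷ [])
  S4∪-doubling dia  = inj₁ d-dd
  S4∪-doubling bdia = inj₁ b-bb

  L-S4∪-++ : ∀ {a s t} → L (S4 ∪S G) a s → L (S4 ∪S G) a t → L (S4 ∪S G) a (s ++ t)
  L-S4∪-++ {a} ds dt = Derives-trans (rewrite-once (S4∪-doubling a)) (Derives-++ ds dt)

_++ᴾ_ : ∀ {R a b c s t} → PPath R a b s → PPath R b c t → PPath R a c (s ++ t)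
here      ++ᴾ q = q
fwd r p   ++ᴾ q = fwd r (p ++ᴾ q)
bwd r p   ++ᴾ q = bwd r (p ++ᴾ q)

RPow⇒PPath : ∀ {R} n {w u} → RPow R n w u → PPath R w u (replicate n dia)
RPow⇒PPath zero    refl          = here
RPow⇒PPath (suc n) (_ , r , rs)  = fwd r (RPow⇒PPath n rs)

RPow⇒PPath⁻¹ : ∀ {R} n {w u} → RPow R n w u → PPath R u w (replicate n bdia)
RPow⇒PPath⁻¹ zero    refl         = here
RPow⇒PPath⁻¹ (suc n) (_ , r , rs) =
  subst (PPath _ _ _) (replicate-snoc n) (RPow⇒PPath⁻¹ n rs ++ᴾ bwd r here)
  where
  replicate-snoc : ∀ n → replicate n bdia ++ bdia ∷ [] ≡ bdia ∷ replicate n bdia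
  replicate-snoc zero    = refl
  replicate-snoc (suc n) = cong (bdia ∷_) (replicate-snoc n)

fresh-label-⊆ : ∀ {R R' Γ Δ u} → R ⊆ R' →
                u ∉ labelsS (R' ▸ Γ ⊢ Δ) → u ∉ labelsS (R ▸ Γ ⊢ Δ)
fresh-label-⊆ sub f = f ∘ ++⁺ˡ _ (concatMap⁺ labR sub)

fresh-var-⊆ : ∀ {R R' Γ Δ x} → R ⊆ R' →
              x ∉ varsS (R' ▸ Γ ⊢ Δ) → x ∉ varsS (R ▸ Γ ⊢ Δ)
fresh-var-⊆ sub f = f ∘ ++⁺ˡ _ (concatMap⁺ varR sub)

module _ {C : FrameConds} where

  S2Cond-refl : ∀ {R w} → S2Cond C R w w
  S2Cond-refl with hasI C | hasD C
  ... | true  | true  = [] , here , S5-universal []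
  ... | true  | false = [] , here , rewrite-once (inj₁ b-ε)
  ... | false | true  = [] , here , rewrite-once (inj₁ d-ε)
  ... | false | false = refl

  S2Cond-trans : ∀ {R w u v} → S2Cond C R w u → S2Cond C R u v → S2Cond C R w v
  S2Cond-trans c c' with hasI C | hasD C
  ... | true  | true  = let (s , p , _) = c ; (t , q , _) = c' in s ++ t , p ++ᴾ q , S5-universal (s ++ t)
  ... | true  | false = let (s , p , l) = c ; (t , q , l') = c' in s ++ t , p ++ᴾ q , L-S4∪-++ l l'
  ... | false | true  = let (s , p , l) = c ; (t , q , l') = c' in s ++ t , p ++ᴾ q , L-S4∪-++ l l'
  ... | false | false = trans c c'

  S2Cond-backward : ∀ {R w u} → T (hasI C) → rel w u ∈ R → S2Cond C R u w
  S2Cond-backward h r with hasI C | hasD C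
  S2Cond-backward h r | true  | true  = bdia ∷ [] , bwd r here , S5-universal (bdia ∷ [])
  S2Cond-backward h r | true  | false = bdia ∷ [] , bwd r here , done
  S2Cond-backward () r | false | _

  S2Cond-forward : ∀ {R w u} → T (hasD C) → rel w u ∈ R → S2Cond C R w u
  S2Cond-forward h r with hasI C | hasD C
  S2Cond-forward h r | true  | true  = dia ∷ [] , fwd r here , S5-universal (dia ∷ [])
  S2Cond-forward h r | false | true  = dia ∷ [] , fwd r here , done
  S2Cond-forward () r | _     | false

  S1Cond⇒S2Cond : ∀ {R y w} → S1Cond C R y w → ∃[ u ] (dom y u ∈ R × S2Cond C R w u)
  S1Cond⇒S2Cond c with hasI C | hasD C
  ... | true  | true  = c
  ... | true  | false = c
  ... | false | true  = c
  ... | false | false = _ , c , refl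

  S2Cond⇒S1Cond : ∀ {R y w u} → dom y u ∈ R → S2Cond C R w u → S1Cond C R y w
  S2Cond⇒S1Cond m c with hasI C | hasD C
  ... | true  | true  = _ , m , c
  ... | true  | false = _ , m , c
  ... | false | true  = _ , m , c
  ... | false | false = subst (λ v → dom _ v ∈ _) (sym c) m

  dom⇒S1Cond : ∀ {R y w} → dom y w ∈ R → S1Cond C R y w
  dom⇒S1Cond m = S2Cond⇒S1Cond m S2Cond-refl

  Redundant : List RAtom → RAtom → Set
  Redundant R (rel u v) = PathIn (SG C) dia R u v × PathIn (SG C) bdia R v u
  Redundant R (dom y u) = ∃[ u' ] (dom y u' ∈ R × S2Cond C R u u')

  EdgesRedundant : List RAtom → List RAtom → Set
  EdgesRedundant R' R = ∀ {u v} → rel u v ∈ R' → Redundant R (rel u v)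

  ∈⇒Redundant : ∀ {R a} → a ∈ R → Redundant R a
  ∈⇒Redundant {a = rel _ _} m = (dia ∷ [] , fwd m here , done) , (bdia ∷ [] , bwd m here , done)
  ∈⇒Redundant {a = dom _ u} m = u , m , S2Cond-refl

  ⊆⇒EdgesRedundant : ∀ {R R'} → (∀ {u v} → rel u v ∈ R' → rel u v ∈ R) → EdgesRedundant R' R
  ⊆⇒EdgesRedundant sub m = ∈⇒Redundant (sub m)

  PPath-reduce : ∀ {R R' w u s} → EdgesRedundant R' R → PPath R' w u s →
                 ∃[ s' ] (PPath R w u s' × Derives (SG C) s s')
  PPath-reduce E here = [] , here , done
  PPath-reduce E (fwd r p) =
    let (t , q , dt) , _ = E r ; (s' , p' , ds) = PPath-reduce E p
    in t ++ s' , q ++ᴾ p' , Derives-++ dt ds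
  PPath-reduce E (bwd r p) =
    let _ , (t , q , dt) = E r ; (s' , p' , ds) = PPath-reduce E p
    in t ++ s' , q ++ᴾ p' , Derives-++ dt ds

  PathIn-reduce : ∀ {G a R R' w u} → (∀ {b t} → SG C b t → G b t) → EdgesRedundant R' R →
                  PathIn G a R' w u → PathIn G a R w u
  PathIn-reduce f E (s , p , l) =
    let (s' , p' , δ) = PPath-reduce E p in s' , p' , Derives-trans l (Derives-mono f δ)

  S2Cond-reduce : ∀ {R R' w u} → EdgesRedundant R' R → S2Cond C R' w u → S2Cond C R w u
  S2Cond-reduce E c with hasI C | hasD C
  ... | true  | true  = let (s , p , _) = c ; (s' , p' , _) = PPath-reduce E p in s' , p' , S5-universal s'
  ... | true  | false = PathIn-reduce inj₂ E c
  ... | false | true  = PathIn-reduce inj₂ E c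
  ... | false | false = c

  S1Cond-reduce : ∀ {R R' y w} → EdgesRedundant R' R →
                  (∀ {u} → dom y u ∈ R' → Redundant R (dom y u)) →
                  S1Cond C R' y w → S1Cond C R y w
  S1Cond-reduce E D c =
    let (_ , m , r) = S1Cond⇒S2Cond c ; (_ , m' , r') = D m
    in S2Cond⇒S1Cond m' (S2Cond-trans (S2Cond-reduce E r) r')

  Redundant-⊆ : ∀ {R R₂} → R ⊆ R₂ → ∀ {a} → Redundant R a → Redundant R₂ a
  Redundant-⊆ sub {rel _ _} (p , q) =
    PathIn-reduce (λ g → g) (⊆⇒EdgesRedundant sub) p ,
    PathIn-reduce (λ g → g) (⊆⇒EdgesRedundant sub) q
  Redundant-⊆ sub {dom _ _} (u' , m , c) = u' , sub m , S2Cond-reduce (⊆⇒EdgesRedundant sub) c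

  Reduces : List RAtom → List RAtom → Set
  Reduces R' R = ∀ {a} → a ∈ R' → Redundant R a

  Reduces-∷ : ∀ {R R' a} → Reduces R' R → Reduces (a ∷ R') (a ∷ R)
  Reduces-∷ red (here refl) = ∈⇒Redundant (here refl)
  Reduces-∷ red (there m)   = Redundant-⊆ there (red m)

  QKL-reduce : ∀ {R R' Γ Δ} → R ⊆ R' → Reduces R' R → QKL C (R' ▸ Γ ⊢ Δ) → QKL C (R ▸ Γ ⊢ Δ)
  QKL-reduce sub red (ax a b) = ax a b
  QKL-reduce sub red (⊥l a) = ⊥l a
  QKL-reduce sub red (¬l p D) = ¬l p (QKL-reduce sub red D)
  QKL-reduce sub red (¬r p D) = ¬r p (QKL-reduce sub red D)
  QKL-reduce sub red (∨l p D E) = ∨l p (QKL-reduce sub red D) (QKL-reduce sub red E)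
  QKL-reduce sub red (∨r p D) = ∨r p (QKL-reduce sub red D)
  QKL-reduce {Γ = Γ} {Δ} sub red (◇l p f D) =
    ◇l p (fresh-label-⊆ {Γ = Γ} {Δ} sub f) (QKL-reduce (∷⁺ʳ _ sub) (Reduces-∷ red) D)
  QKL-reduce sub red (◇r r m D) = p◇ (proj₁ (red r)) m (QKL-reduce sub red D)
  QKL-reduce {Γ = Γ} {Δ} sub red (∃l p f D) =
    ∃l p (fresh-var-⊆ {Γ = Γ} {Δ} sub f) (QKL-reduce (∷⁺ʳ _ sub) (Reduces-∷ red) D)
  QKL-reduce sub red (∃r m m' D) =
    let (_ , mu , c) = red m in s∃¹ (S2Cond⇒S1Cond mu c) m' (QKL-reduce sub red D)
  QKL-reduce {Γ = Γ} {Δ} sub red (d s f D) =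
    d s (fresh-label-⊆ {Γ = Γ} {Δ} sub f) (QKL-reduce (∷⁺ʳ _ sub) (Reduces-∷ red) D)
  QKL-reduce sub red (p◇ q m D) = p◇ (PathIn-reduce (λ g → g) red q) m (QKL-reduce sub red D)
  QKL-reduce sub red (s∃¹ c m D) = s∃¹ (S1Cond-reduce red red c) m (QKL-reduce sub red D)
  QKL-reduce {Γ = Γ} {Δ} sub red (s∃² n f c m D) =
    s∃² n (fresh-var-⊆ {Γ = Γ} {Δ} sub f) (S2Cond-reduce red c) m
      (QKL-reduce (∷⁺ʳ _ sub) (Reduces-∷ red) D)

  QKL-drop-redundant : ∀ {R a Γ Δ} → Redundant R a → QKL C (a ∷ R ▸ Γ ⊢ Δ) → QKL C (R ▸ Γ ⊢ Δ)
  QKL-drop-redundant {R} {a} red = QKL-reduce (xs⊆x∷xs R a) λ where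
    (here refl) → red
    (there m)   → ∈⇒Redundant m

  g-redundant : ∀ {R n k w u v} → FrameConds.Gpc C n k → RPow R n w u → RPow R k w v →
                Redundant R (rel u v)
  g-redundant {n = n} {k} gp p q =
    (_ , RPow⇒PPath⁻¹ n p ++ᴾ RPow⇒PPath k q , rewrite-once (n , k , gp , refl)) ,
    (_ , RPow⇒PPath⁻¹ k q ++ᴾ RPow⇒PPath n p , rewrite-once (n , k , gp , refl))

FreshIn : Var → LFormula → Set
FreshIn x A = x ∉ fvF (LFormula.form A)

∷-++-⊆ : ∀ {A : Set} {y : A} {xs xs' ys ys'} →
         xs ⊆ y ∷ xs' → ys ⊆ y ∷ ys' → xs ++ ys ⊆ y ∷ xs' ++ ys'
∷-++-⊆ {xs = xs} {xs'} p q m with ∈-++⁻ xs m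
... | inj₁ m' with p m'
...   | here e  = here e
...   | there n = there (∈-++⁺ˡ n)
∷-++-⊆ {xs = xs} {xs'} p q m | inj₂ m' with q m'
...   | here e  = here e
...   | there n = there (∈-++⁺ʳ xs' n)

fvT-openT : ∀ i y t → fvT (openT i y t) ⊆ y ∷ fvT t
fvT-openT i y (bv j) with i ≟ j
... | yes _ = ⊆-refl
... | no _  = λ ()
fvT-openT i y (fv _) = xs⊆x∷xs _ y

fvF-openF : ∀ i y φ → fvF (openF i y φ) ⊆ y ∷ fvF φ
fvF-openF i y (atom p ts) = terms ts
  where
  terms : ∀ ts → concatMap fvT (map (openT i y) ts) ⊆ y ∷ concatMap fvT ts
  terms []       = λ ()
  terms (t ∷ ts) = ∷-++-⊆ (fvT-openT i y t) (terms ts)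
fvF-openF i y ⊥f       = λ ()
fvF-openF i y (¬f φ)   = fvF-openF i y φ
fvF-openF i y (φ ∨f ψ) = ∷-++-⊆ (fvF-openF i y φ) (fvF-openF i y ψ)
fvF-openF i y (◇f φ)   = fvF-openF i y φ
fvF-openF i y (∃f φ)   = fvF-openF (suc i) y φ

fresh-[] : ∀ {x y} φ → x ≢ y → x ∉ fvF φ → x ∉ fvF (φ [ y ])
fresh-[] {y = y} φ x≢y f m with fvF-openF 0 y φ m
... | here e  = x≢y e
... | there n = f n

fresh-↭ : ∀ {x Γ A Γ'} → All (FreshIn x) Γ → Γ ↭ A ∷ Γ' → FreshIn x A × All (FreshIn x) Γ'
fresh-↭ f p = uncons (All-resp-↭ p f)

dom∈⇒∈varsS : ∀ {R Γ Δ x u} → dom x u ∈ R → x ∈ varsS (R ▸ Γ ⊢ Δ)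
dom∈⇒∈varsS m = ∈-++⁺ˡ (∈-concat⁺′ (here refl) (∈-map⁺ varR m))

record FreshSequent (x : Var) (R : List RAtom) (Γ Δ : List LFormula) : Set where
  field
    fresh-R : ∀ {u} → dom x u ∉ R
    fresh-Γ : All (FreshIn x) Γ
    fresh-Δ : All (FreshIn x) Δ

∉varsS⇒FreshSequent : ∀ {x R Γ Δ} → x ∉ varsS (R ▸ Γ ⊢ Δ) → FreshSequent x R Γ Δ
∉varsS⇒FreshSequent {R = R} {Γ} {Δ} f = record
  { fresh-R = f ∘ dom∈⇒∈varsS {Γ = Γ} {Δ}
  ; fresh-Γ = ¬Any⇒All¬ Γ (f ∘ ∈-++⁺ʳ (concatMap varR R) ∘ ∈-++⁺ˡ ∘ ∈-concatMap⁺ _)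
  ; fresh-Δ = ¬Any⇒All¬ Δ
      (f ∘ ∈-++⁺ʳ (concatMap varR R) ∘ ∈-++⁺ʳ (concatMap _ Γ) ∘ ∈-concatMap⁺ _)
  }

FreshSequent⇒∉varsS : ∀ {x R Γ Δ} → FreshSequent x R Γ Δ → x ∉ varsS (R ▸ Γ ⊢ Δ)
FreshSequent⇒∉varsS {R = R} {Γ} fs m with ∈-++⁻ (concatMap varR R) m
... | inj₁ mR with find (∈-concatMap⁻ varR mR)
...   | dom _ _ , a , here refl = FreshSequent.fresh-R fs a
FreshSequent⇒∉varsS {R = R} {Γ} fs m | inj₂ m' with ∈-++⁻ (concatMap _ Γ) m'
... | inj₁ mΓ = All¬⇒¬Any (FreshSequent.fresh-Γ fs) (∈-concatMap⁻ _ mΓ)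
... | inj₂ mΔ = All¬⇒¬Any (FreshSequent.fresh-Δ fs) (∈-concatMap⁻ _ mΔ)

module NonEmptyDomains {C : FrameConds} (nonE : T (FrameConds.NonE C)) {x : Var} {w : Label} where

  record Invariant (R R' : List RAtom) (Γ Δ : List LFormula) : Set where
    field
      sub     : R ⊆ R'
      sup     : R' ⊆ dom x w ∷ R
      witness : dom x w ∈ R'
      fresh   : FreshSequent x R Γ Δ
    open FreshSequent fresh public
  open Invariant

  reframe : ∀ {R R' Γ Δ Γ₂ Δ₂} → Invariant R R' Γ Δ →
            All (FreshIn x) Γ₂ → All (FreshIn x) Δ₂ → Invariant R R' Γ₂ Δ₂
  reframe i fΓ fΔ = record
    { sub = sub i ; sup = sup i ; witness = witness i
    ; fresh = record { fresh-R = fresh-R i ; fresh-Γ = fΓ ; fresh-Δ = fΔ } }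

  reframe-Δ : ∀ {R R' Γ Δ A} → Invariant R R' Γ Δ → FreshIn x A → Invariant R R' Γ (A ∷ Δ)
  reframe-Δ i fA = reframe i (fresh-Γ i) (fA ∷ fresh-Δ i)

  extend : ∀ {R R' Γ Δ Γ₂ Δ₂ a} → Invariant R R' Γ Δ → (∀ {u} → dom x u ≢ a) →
           All (FreshIn x) Γ₂ → All (FreshIn x) Δ₂ → Invariant (a ∷ R) (a ∷ R') Γ₂ Δ₂
  extend {a = a} i x∉a fΓ fΔ = record
    { sub     = ∷⁺ʳ a (sub i)
    ; sup     = ⊆-trans (∷⁺ʳ a (sup i)) (⊆-reflexive-↭ (↭.swap a (dom x w) ↭.refl))
    ; witness = there (witness i)
    ; fresh   = record
      { fresh-R = λ { (here e) → x∉a e ; (there m) → fresh-R i m }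
      ; fresh-Γ = fΓ
      ; fresh-Δ = fΔ } }

  rel∈R : ∀ {R R' Γ Δ} → Invariant R R' Γ Δ → ∀ {u v} → rel u v ∈ R' → rel u v ∈ R
  rel∈R i m with sup i m
  ... | there m' = m'

  dom-other : ∀ {R R' Γ Δ y u} → Invariant R R' Γ Δ → y ≢ x → dom y u ∈ R' → dom y u ∈ R
  dom-other i y≢x m with sup i m
  ... | here refl = ⊥-elim (y≢x refl)
  ... | there m'  = m'

  dom-x⇒w : ∀ {R R' Γ Δ u} → Invariant R R' Γ Δ → dom x u ∈ R' → u ≡ w
  dom-x⇒w i m with sup i m
  ... | here refl = refl
  ... | there m'  = ⊥-elim (fresh-R i m')

  x≢fresh : ∀ {R R' Γ Δ y} → Invariant R R' Γ Δ → y ∉ varsS (R' ▸ Γ ⊢ Δ) → x ≢ y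
  x≢fresh {Γ = Γ} {Δ} i f refl = f (dom∈⇒∈varsS {Γ = Γ} {Δ} (witness i))

  mutual
    eliminate : ∀ {R R' Γ Δ} → Invariant R R' Γ Δ → QKL C (R' ▸ Γ ⊢ Δ) → QKL C (R ▸ Γ ⊢ Δ)
    eliminate i (ax a b) = ax a b
    eliminate i (⊥l a)   = ⊥l a
    eliminate i (¬l p D) =
      let (fφ , fΓ) = fresh-↭ (fresh-Γ i) p in ¬l p (eliminate (reframe i fΓ (fφ ∷ fresh-Δ i)) D)
    eliminate i (¬r p D) =
      let (fφ , fΔ) = fresh-↭ (fresh-Δ i) p in ¬r p (eliminate (reframe i (fφ ∷ fresh-Γ i) fΔ) D)
    eliminate i (∨l p D E) =
      let (fφψ , fΓ) = fresh-↭ (fresh-Γ i) p in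
      ∨l p (eliminate (reframe i (fφψ ∘ ∈-++⁺ˡ ∷ fΓ) (fresh-Δ i)) D)
           (eliminate (reframe i (fφψ ∘ ∈-++⁺ʳ _ ∷ fΓ) (fresh-Δ i)) E)
    eliminate i (∨r p D) =
      let (fφψ , fΔ) = fresh-↭ (fresh-Δ i) p in
      ∨r p (eliminate (reframe i (fresh-Γ i) (fφψ ∘ ∈-++⁺ˡ ∷ fφψ ∘ ∈-++⁺ʳ _ ∷ fΔ)) D)
    eliminate {Γ = Γ} {Δ} i (◇l p f D) =
      let (fφ , fΓ) = fresh-↭ (fresh-Γ i) p in
      ◇l p (fresh-label-⊆ {Γ = Γ} {Δ} (sub i) f) (eliminate (extend i (λ ()) (fφ ∷ fΓ) (fresh-Δ i)) D)
    eliminate i (◇r r m D) =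
      ◇r (rel∈R i r) m (eliminate (reframe-Δ i (lookup (fresh-Δ i) m)) D)
    eliminate {Γ = Γ} {Δ} i (∃l {φ = φ} p f D) =
      let (fφ , fΓ) = fresh-↭ (fresh-Γ i) p ; x≢y = x≢fresh i f in
      ∃l p (fresh-var-⊆ {Γ = Γ} {Δ} (sub i) f)
        (eliminate (extend i (λ { refl → x≢y refl }) (fresh-[] φ x≢y fφ ∷ fΓ) (fresh-Δ i)) D)
    eliminate i (∃r m m' D) = eliminate-s∃¹ i (dom⇒S1Cond m) m' D
    eliminate {Γ = Γ} {Δ} i (d s f D) =
      d s (fresh-label-⊆ {Γ = Γ} {Δ} (sub i) f) (eliminate (extend i (λ ()) (fresh-Γ i) (fresh-Δ i)) D)
    eliminate i (p◇ q m D) =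
      p◇ (PathIn-reduce (λ g → g) (⊆⇒EdgesRedundant (rel∈R i)) q) m
        (eliminate (reframe-Δ i (lookup (fresh-Δ i) m)) D)
    eliminate i (s∃¹ c m D) = eliminate-s∃¹ i c m D
    eliminate {Γ = Γ} {Δ} i (s∃² {φ = φ} n f c m D) =
      let x≢y = x≢fresh i f in
      s∃² n (fresh-var-⊆ {Γ = Γ} {Δ} (sub i) f) (S2Cond-reduce (⊆⇒EdgesRedundant (rel∈R i)) c) m
        (eliminate (extend i (λ { refl → x≢y refl }) (fresh-Γ i)
                     (fresh-[] φ x≢y (lookup (fresh-Δ i) m) ∷ fresh-Δ i)) D)

    eliminate-s∃¹ : ∀ {R R' Γ Δ y v φ} → Invariant R R' Γ Δ →
                    S1Cond C R' y v → (v ∶ (∃f φ)) ∈ Δ →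
                    QKL C (R' ▸ Γ ⊢ ((v ∶ (φ [ y ])) ∷ Δ)) → QKL C (R ▸ Γ ⊢ Δ)
    eliminate-s∃¹ {y = y} {φ = φ} i c m D with y ≟ x
    ... | no y≢x =
      s∃¹ (S1Cond-reduce (⊆⇒EdgesRedundant (rel∈R i)) (∈⇒Redundant ∘ dom-other i y≢x) c) m
        (eliminate (reframe-Δ i (fresh-[] φ (y≢x ∘ sym) (lookup (fresh-Δ i) m))) D)
    ... | yes refl =
      let (_ , mu , r) = S1Cond⇒S2Cond c in
      s∃² nonE (FreshSequent⇒∉varsS (fresh i))
        (subst (S2Cond C _ _) (dom-x⇒w i mu) (S2Cond-reduce (⊆⇒EdgesRedundant (rel∈R i)) r)) m
        (QKL-reduce (∈-∷⁺ʳ (witness i) (sub i)) (∈⇒Redundant ∘ sup i) D)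

  QKL-drop-fresh-domain : ∀ {R Γ Δ} → x ∉ varsS (R ▸ Γ ⊢ Δ) →
                          QKL C (dom x w ∷ R ▸ Γ ⊢ Δ) → QKL C (R ▸ Γ ⊢ Δ)
  QKL-drop-fresh-domain {R} f = eliminate record
    { sub = xs⊆x∷xs R (dom x w) ; sup = ⊆-refl ; witness = here refl ; fresh = ∉varsS⇒FreshSequent f }

mainTheorem4 : (C : FrameConds) (S : Sequent) → G3QK C S → QKL C S
mainTheorem4 C _ (ax a b)       = ax a b
mainTheorem4 C _ (⊥l a)         = ⊥l a
mainTheorem4 C _ (¬l p D)       = ¬l p (mainTheorem4 C _ D)
mainTheorem4 C _ (¬r p D)       = ¬r p (mainTheorem4 C _ D)
mainTheorem4 C _ (∨l p D E)     = ∨l p (mainTheorem4 C _ D) (mainTheorem4 C _ E)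
mainTheorem4 C _ (∨r p D)       = ∨r p (mainTheorem4 C _ D)
mainTheorem4 C _ (◇l p f D)     = ◇l p f (mainTheorem4 C _ D)
mainTheorem4 C _ (◇r r m D)     = ◇r r m (mainTheorem4 C _ D)
mainTheorem4 C _ (∃l p f D)     = ∃l p f (mainTheorem4 C _ D)
mainTheorem4 C _ (∃r m m' D)    = ∃r m m' (mainTheorem4 C _ D)
mainTheorem4 C _ (d s f D)      = d s f (mainTheorem4 C _ D)
mainTheorem4 C _ (g gp p q D)   = QKL-drop-redundant (g-redundant gp p q) (mainTheorem4 C _ D)
mainTheorem4 C _ (id h r m D)   = QKL-drop-redundant (_ , m , S2Cond-backward h r) (mainTheorem4 C _ D)
mainTheorem4 C _ (dd h r m D)   = QKL-drop-redundant (_ , m , S2Cond-forward h r) (mainTheorem4 C _ D)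
mainTheorem4 C _ (nd h f D)     = NonEmptyDomains.QKL-drop-fresh-domain h f (mainTheorem4 C _ D)
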